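{- Let $n$ be a positive integer that is not a perfect square. Then the set of corresponding sequences for $g(n)$ is in bijection with the null space (over $\mathbb{F}_2$) of the matrix $A(n+1, g(n))$.
   Context: For a non-negative integer $n$, $g(n)$ is the least integer $k$ such that there is a strictly increasing sequence of integers $n = a_1 < \cdots < a_t = k$ whose product is a perfect square; such a sequence starting at $n$ and ending at $g(n)$ is called a corresponding sequence for $g(n)$. For a positive integer $x = \prod_i p_i^{v_i}$ ($p_i$ the $i$-th prime), $\vec{v}(x) \in \mathbb{F}_2^N$ is $(v_1 \bmod 2, \dots, v_N \bmod 2)^T$ with $N \geq \pi(g(n))$ ($\pi$ the prime-counting function). $A(\ell, r)$ is the matrix over $\mathbb{F}_2$ whose columns are $\vec{v}(\ell), \vec{v}(\ell+1), \dots, \vec{v}(r)$. -}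

module Defs where

open import Data.Bool using (Bool; true; false; _xor_; _∧_; if_then_else_)
open import Data.Nat using (ℕ; zero; suc; _+_; _*_; _∸_; _<_; _/_)
open import Data.Nat.Divisibility using (_∣?_)
open import Data.Nat.Primality using (Prime)
open import Data.Fin using (Fin; toℕ)
open import Data.Vec using (Vec; tabulate; foldr; zipWith)
open import Data.List using (List; head; last)
open import Data.Nat.ListAction using (product)
open import Data.List.Relation.Unary.Linked using (Linked)
open import Data.Maybe using (just)
open import Data.Product using (Σ; ∃-syntax; _×_; proj₁)
open import Relation.Nullary using (¬_; does)
open import Relation.Binary.PropositionalEquality using (_≡_; setoid)
open import Relation.Binary.Bundles using (Setoid)
import Relation.Binary.Construct.On as On

IsSquare : ℕ → Set
IsSquare x = ∃[ m ] (m * m ≡ x)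

IsCorrSeq : ℕ → ℕ → List ℕ → Set
IsCorrSeq n k as =
  (head as ≡ just n) × Linked _<_ as × (last as ≡ just k) × IsSquare (product as)

CorrSeq : ℕ → ℕ → Set
CorrSeq n k = Σ (List ℕ) (IsCorrSeq n k)

IsG : ℕ → ℕ → Set
IsG n k = CorrSeq n k × (∀ k′ → k′ < k → ¬ CorrSeq n k′)

CorrSeqSetoid : ℕ → ℕ → Setoid _ _
CorrSeqSetoid n k = On.setoid (setoid (List ℕ)) (proj₁ {B = IsCorrSeq n k})

-- p-adic valuation (for p ≥ 2 and x ≥ 1), computed with fuel
valAux : ℕ → ℕ → ℕ → ℕ
valAux zero    p             x = 0
valAux (suc f) zero          x = 0
valAux (suc f) (suc zero)    x = 0
valAux (suc f) (suc (suc q)) x =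
  if does (suc (suc q) ∣? x) then suc (valAux f (suc (suc q)) (x / suc (suc q))) else 0

val : ℕ → ℕ → ℕ
val p x = valAux x p x

parity : ℕ → Bool
parity zero          = false
parity (suc zero)    = true
parity (suc (suc m)) = parity m

vbit : ℕ → ℕ → Bool
vbit p x = parity (val p x)

dot : ∀ {m} → Vec Bool m → Vec Bool m → Bool
dot u w = foldr _ _xor_ false (zipWith _∧_ u w)

-- rows of the matrices: the primes p ≤ B  (i.e. N = π(B) rows)
PrimeRow : ℕ → Set
PrimeRow B = Σ (Fin (suc B)) (λ p → Prime (toℕ p))

-- row of A(ℓ, r) for prime p: (v_p(ℓ) mod 2, …, v_p(r) mod 2); columns ℓ, …, r
rowA : (ℓ r : ℕ) → ℕ → Vec Bool (suc r ∸ ℓ)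
rowA ℓ r p = tabulate (λ j → vbit p (ℓ + toℕ j))

InNullSpace : (B ℓ r : ℕ) → Vec Bool (suc r ∸ ℓ) → Set
InNullSpace B ℓ r x = ∀ (p : PrimeRow B) → dot (rowA ℓ r (toℕ (proj₁ p))) x ≡ false

NullSpace : (B ℓ r : ℕ) → Set
NullSpace B ℓ r = Σ (Vec Bool (suc r ∸ ℓ)) (InNullSpace B ℓ r)

NullSpaceSetoid : (B ℓ r : ℕ) → Setoid _ _
NullSpaceSetoid B ℓ r = On.setoid (setoid (Vec Bool (suc r ∸ ℓ))) (proj₁ {B = InNullSpace B ℓ r})

module Submission where

-- A corresponding sequence for k = g(n) is n followed by a set S ⊆ {n+1, …, k}, encoded by its indicator
-- vector x_S.  Every prime dividing the product is at most k, so the product is a square exactly when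
-- every p ≤ k occurs to an even power, i.e. when A(n+1, k) x_S = v(n).  Fixing one corresponding
-- sequence S₀, the map S ↦ x_S + x_{S₀} therefore lands in the null space, and it is onto: for x in the
-- null space, the sequence of x + x_{S₀} has square product, so it goes beyond n (n is not a square) and
-- it ends exactly at k, because it cannot stop before k = g(n).

open import Defs
open import Algebra.Bundles using (CommutativeRing)
open import Data.Bool using (Bool; true; false; _xor_; _∧_; not)
open import Data.Bool.Properties
  using (xor-same; xor-identityʳ; ∧-identityʳ; ∧-zeroʳ; ∧-distribˡ-xor; xor-∧-commutativeRing)
open import Data.Empty using (⊥-elim)
open import Data.Fin using (toℕ; fromℕ<)
open import Data.Fin.Properties using (toℕ-fromℕ<)
open import Data.List using (List; []; _∷_; last)
open import Data.List.Properties using (∷-injectiveʳ)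
open import Data.List.Relation.Unary.All as All using (All; []; _∷_)
open import Data.List.Relation.Unary.AllPairs using (AllPairs; []; _∷_)
open import Data.List.Relation.Unary.Linked using (Linked; [-]; _∷_)
open import Data.List.Relation.Unary.Linked.Properties using (Linked⇒AllPairs; AllPairs⇒Linked)
open import Data.Maybe using (just)
open import Data.Nat hiding (parity)
open import Data.Nat.Divisibility
open import Data.Nat.DivMod using (m*n/n≡m)
open import Data.Nat.Induction using (<-rec)
open import Data.Nat.ListAction using (product)
open import Data.Nat.ListAction.Properties using (product≢0)
open import Data.Nat.Primality using (Prime; euclidsLemma; prime⇒nonTrivial; prime⇒nonZero)
open import Data.Nat.Primality.Factorisation using (factorise)
open import Data.Nat.Properties
open import Data.Nat.Solver using (module +-*-Solver)
open import Data.Product using (∃-syntax; _×_; _,_; proj₁; proj₂)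
open import Data.Sum using ([_,_]′)
open import Data.Vec using (Vec; []; _∷_; zipWith; tabulate)
open import Data.Vec.Properties using (tabulate-cong)
open import Function using (_∘_)
open import Function.Bundles using (Bijection)
open import Relation.Binary.PropositionalEquality
open import Relation.Nullary using (¬_; yes; no)
open import Relation.Nullary.Decidable using (dec-true; dec-false)

open +-*-Solver using (solve; _:*_; _:=_)
open import Algebra.Properties.CommutativeSemigroup
  (CommutativeRing.+-commutativeSemigroup xor-∧-commutativeRing) using (interchange)

private
  variable
    c p v x : ℕ

prime⇒>1 : Prime p → 1 < p
prime⇒>1 {p} p-prime = nonTrivial⇒n>1 p {{prime⇒nonTrivial p-prime}}

n<m^n : ∀ {m} → 1 < m → ∀ n → n < m ^ n
n<m^n 1<m zero    = s≤s z≤n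
n<m^n 1<m (suc n) = ≤-<-trans (n<m^n 1<m n) (^-monoʳ-< _ 1<m (n<1+n n))

>1⇒∤1 : 1 < p → p ∤ 1
>1⇒∤1 1<p = <⇒≢ 1<p ∘ sym ∘ ∣1⇒≡1

val-∤ : p ∤ x → val p x ≡ 0
val-∤ {x = zero}                    _   = refl
val-∤ {zero}          {suc x}       _   = refl
val-∤ {suc zero}      {suc x}       _   = refl
val-∤ {suc (suc q)}   {suc x}       p∤x rewrite dec-false (suc (suc q) ∣? suc x) p∤x = refl

-- The fuel of valAux only has to exceed the valuation.
valAux-pow* : ∀ q → suc (suc q) ∤ c → ∀ v f → v < f →
              valAux f (suc (suc q)) (suc (suc q) ^ v * c) ≡ v
valAux-pow* {c} q p∤c zero (suc f) _
  rewrite *-identityˡ c | dec-false (suc (suc q) ∣? c) p∤c = refl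
valAux-pow* {c} q p∤c (suc v) (suc f) (s≤s v<f)
  rewrite dec-true (suc (suc q) ∣? suc (suc q) ^ suc v * c) (∣m⇒∣m*n c (m∣m*n (suc (suc q) ^ v)))
  = cong suc (trans (cong (valAux f P) divide) (valAux-pow* q p∤c v f v<f))
  where
  P = suc (suc q)
  divide : P ^ suc v * c / P ≡ P ^ v * c
  divide = begin
    P * P ^ v * c / P   ≡⟨ cong (_/ P) (*-assoc P (P ^ v) c) ⟩
    P * (P ^ v * c) / P ≡⟨ cong (_/ P) (*-comm P (P ^ v * c)) ⟩
    P ^ v * c * P / P   ≡⟨ m*n/n≡m (P ^ v * c) P ⟩
    P ^ v * c           ∎
    where open ≡-Reasoning

val-pow* : 1 < p → p ∤ c → x ≡ p ^ v * c → val p x ≡ v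
val-pow* {suc zero} (s≤s ())
val-pow* {suc (suc q)} {zero}  _   p∤c _    = ⊥-elim (p∤c (_ ∣0))
val-pow* {suc (suc q)} {suc c} {v = v} 1<p p∤c refl =
  valAux-pow* q p∤c v _ (<-≤-trans (n<m^n 1<p v) (m≤m*n _ (suc c)))

pow*-decomposition : 1 < p → ∀ x → .{{NonZero x}} → ∃[ v ] ∃[ c ] p ∤ c × x ≡ p ^ v * c
pow*-decomposition {p} 1<p = <-rec _ step
  where
  step : ∀ x → (∀ {y} → y < x → .{{NonZero y}} → ∃[ v ] ∃[ c ] p ∤ c × y ≡ p ^ v * c) →
         .{{NonZero x}} → ∃[ v ] ∃[ c ] p ∤ c × x ≡ p ^ v * c
  step x rec with p ∣? x
  ... | no p∤x = 0 , x , p∤x , sym (*-identityˡ x)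
  ... | yes p∣x with rec (quotient-< p∣x {{n>1⇒nonTrivial 1<p}}) {{quotient≢0 p∣x}}
  ...   | v , c , p∤c , y≡ = suc v , c , p∤c , (begin
    x                   ≡⟨ m∣n⇒n≡m*quotient p∣x ⟩
    p * quotient p∣x    ≡⟨ cong (p *_) y≡ ⟩
    p * (p ^ v * c)     ≡⟨ *-assoc p (p ^ v) c ⟨
    p ^ suc v * c       ∎)
    where open ≡-Reasoning

val-* : Prime p → ∀ a b → .{{NonZero a}} → .{{NonZero b}} → val p (a * b) ≡ val p a + val p b
val-* {p} p-prime a b
  with pow*-decomposition (prime⇒>1 p-prime) a | pow*-decomposition (prime⇒>1 p-prime) b
... | u , c , p∤c , a≡ | w , d , p∤d , b≡ = begin
  val p (a * b)     ≡⟨ val-pow* 1<p p∤cd ab≡ ⟩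
  u + w             ≡⟨ cong₂ _+_ (val-pow* {v = u} 1<p p∤c a≡) (val-pow* {v = w} 1<p p∤d b≡) ⟨
  val p a + val p b ∎
  where
  open ≡-Reasoning
  1<p = prime⇒>1 p-prime
  p∤cd : p ∤ c * d
  p∤cd = [ p∤c , p∤d ]′ ∘ euclidsLemma c d p-prime
  ab≡ : a * b ≡ p ^ (u + w) * (c * d)
  ab≡ = begin
    a * b                     ≡⟨ cong₂ _*_ a≡ b≡ ⟩
    p ^ u * c * (p ^ w * d)   ≡⟨ solve 4 (λ x y c d → x :* c :* (y :* d) := x :* y :* (c :* d))
                                         refl (p ^ u) (p ^ w) c d ⟩
    p ^ u * p ^ w * (c * d)   ≡⟨ cong (_* (c * d)) (^-distribˡ-+-* p u w) ⟨
    p ^ (u + w) * (c * d)     ∎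

val-self : 1 < p → val p p ≡ 1
val-self {p} 1<p = val-pow* 1<p (>1⇒∤1 1<p) (sym (trans (*-identityʳ (p * 1)) (*-identityʳ p)))

parity-suc : ∀ m → parity (suc m) ≡ not (parity m)
parity-suc zero          = refl
parity-suc (suc zero)    = refl
parity-suc (suc (suc m)) = parity-suc m

parity-+ : ∀ m n → parity (m + n) ≡ parity m xor parity n
parity-+ zero          n = refl
parity-+ (suc zero)    n = parity-suc n
parity-+ (suc (suc m)) n = parity-+ m n

vbit-* : Prime p → ∀ a b → .{{NonZero a}} → .{{NonZero b}} → vbit p (a * b) ≡ vbit p a xor vbit p b
vbit-* {p} p-prime a b = trans (cong parity (val-* p-prime a b)) (parity-+ (val p a) (val p b))

vbit-∤ : p ∤ x → vbit p x ≡ false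
vbit-∤ p∤x = cong parity (val-∤ p∤x)

square⇒vbit≡false : Prime p → IsSquare x → vbit p x ≡ false
square⇒vbit≡false     p-prime (zero  , refl) = refl
square⇒vbit≡false {p} p-prime (suc m , refl) =
  trans (vbit-* p-prime (suc m) (suc m)) (xor-same (vbit p (suc m)))

vbit≡false∧∣⇒p*p∣ : Prime p → .{{NonZero x}} → p ∣ x → vbit p x ≡ false → p * p ∣ x
vbit≡false∧∣⇒p*p∣ {p} {x} p-prime p∣x even with p ∣? quotient p∣x
... | yes p∣y = subst (p * p ∣_) (sym (m∣n⇒n≡quotient*m p∣x)) (*-monoˡ-∣ p p∣y)
... | no p∤y = ⊥-elim (true≢false (begin
  true                              ≡⟨ cong parity (val-self (prime⇒>1 p-prime)) ⟨
  vbit p p                          ≡⟨ cong (_xor vbit p p) (vbit-∤ p∤y) ⟨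
  vbit p y xor vbit p p             ≡⟨ vbit-* p-prime y p ⟨
  vbit p (y * p)                    ≡⟨ cong (vbit p) (m∣n⇒n≡quotient*m p∣x) ⟨
  vbit p x                          ≡⟨ even ⟩
  false                             ∎))
  where
  open ≡-Reasoning
  y = quotient p∣x
  instance
    _ : NonZero y
    _ = quotient≢0 p∣x
    _ : NonZero p
    _ = prime⇒nonZero p-prime
  true≢false : true ≢ false
  true≢false ()

vbit≡false⇒square : ∀ x → .{{NonZero x}} → (∀ p → Prime p → vbit p x ≡ false) → IsSquare x
vbit≡false⇒square = <-rec _ step
  where
  step : ∀ x → (∀ {z} → z < x → .{{NonZero z}} → (∀ p → Prime p → vbit p z ≡ false) → IsSquare z) →
         .{{NonZero x}} → (∀ p → Prime p → vbit p x ≡ false) → IsSquare x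
  step 1 _ _ = 1 , refl
  step x@(2+ _) rec even with factorise x
  ... | record { factors = p ∷ ps ; isFactorisation = x≡ ; factorsPrime = p-prime ∷ _ } =
    m * p , (begin
      m * p * (m * p)  ≡⟨ solve 2 (λ m p → m :* p :* (m :* p) := m :* m :* (p :* p)) refl m p ⟩
      m * m * (p * p)  ≡⟨ cong (_* (p * p)) (proj₂ z-square) ⟩
      z * (p * p)      ≡⟨ m∣n⇒n≡quotient*m pp∣x ⟨
      x                ∎)
    where
    open ≡-Reasoning
    instance
      _ : NonZero p
      _ = prime⇒nonZero p-prime
      _ : NonZero (p * p)
      _ = m*n≢0 p p
      _ : NonTrivial (p * p)
      _ = n>1⇒nonTrivial (*-mono-< (prime⇒>1 p-prime) (prime⇒>1 p-prime))
    p∣x : p ∣ x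
    p∣x = divides (product ps) (trans x≡ (*-comm p (product ps)))
    pp∣x : p * p ∣ x
    pp∣x = vbit≡false∧∣⇒p*p∣ p-prime p∣x (even p p-prime)
    z = quotient pp∣x
    instance
      _ : NonZero z
      _ = quotient≢0 pp∣x
    z-square : IsSquare z
    z-square = rec (quotient-< pp∣x) λ q q-prime → begin
      vbit q z                      ≡⟨ xor-identityʳ (vbit q z) ⟨
      vbit q z xor false            ≡⟨ cong (vbit q z xor_) (square⇒vbit≡false q-prime (p , refl)) ⟨
      vbit q z xor vbit q (p * p)   ≡⟨ vbit-* q-prime z (p * p) ⟨
      vbit q (z * (p * p))          ≡⟨ cong (vbit q) (m∣n⇒n≡quotient*m pp∣x) ⟨
      vbit q x                      ≡⟨ even q q-prime ⟩
      false                         ∎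
    m = proj₁ z-square

xor≡false⇒≡ : ∀ a b → a xor b ≡ false → a ≡ b
xor≡false⇒≡ false false _ = refl
xor≡false⇒≡ true  true  _ = refl

xor-cancelʳ : ∀ a b → (a xor b) xor b ≡ a
xor-cancelʳ false false = refl
xor-cancelʳ false true  = refl
xor-cancelʳ true  false = refl
xor-cancelʳ true  true  = refl

infixl 6 _⊕_
_⊕_ : ∀ {m} → Vec Bool m → Vec Bool m → Vec Bool m
_⊕_ = zipWith _xor_

⊕-cancelʳ : ∀ {m} (x y : Vec Bool m) → x ⊕ y ⊕ y ≡ x
⊕-cancelʳ []      []      = refl
⊕-cancelʳ (a ∷ x) (b ∷ y) = cong₂ _∷_ (xor-cancelʳ a b) (⊕-cancelʳ x y)

⊕-injectiveˡ : ∀ {m} {x y : Vec Bool m} z → x ⊕ z ≡ y ⊕ z → x ≡ y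
⊕-injectiveˡ {x = x} {y} z e = begin
  x         ≡⟨ ⊕-cancelʳ x z ⟨
  x ⊕ z ⊕ z ≡⟨ cong (_⊕ z) e ⟩
  y ⊕ z ⊕ z ≡⟨ ⊕-cancelʳ y z ⟩
  y         ∎
  where open ≡-Reasoning

dot-⊕ : ∀ {m} (r x y : Vec Bool m) → dot r (x ⊕ y) ≡ dot r x xor dot r y
dot-⊕ []      []      []      = refl
dot-⊕ (a ∷ r) (b ∷ x) (c ∷ y) = begin
  a ∧ (b xor c) xor dot r (x ⊕ y)                  ≡⟨ cong₂ _xor_ (∧-distribˡ-xor a b c) (dot-⊕ r x y) ⟩
  (a ∧ b xor a ∧ c) xor (dot r x xor dot r y)      ≡⟨ interchange (a ∧ b) (a ∧ c) (dot r x) (dot r y) ⟩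
  (a ∧ b xor dot r x) xor (a ∧ c xor dot r y)      ∎
  where open ≡-Reasoning

All<-+-suc : ∀ s m {L} → All (_< s + suc m) L → All (_< suc s + m) L
All<-+-suc s m {L} = subst (λ t → All (_< t) L) (+-suc s m)

All<-+-suc⁻¹ : ∀ s m {L} → All (_< suc s + m) L → All (_< s + suc m) L
All<-+-suc⁻¹ s m {L} = subst (λ t → All (_< t) L) (sym (+-suc s m))

support : ∀ {m} → ℕ → Vec Bool m → List ℕ
support s []          = []
support s (true  ∷ x) = s ∷ support (suc s) x
support s (false ∷ x) = support (suc s) x

support-≥ : ∀ {m} s (x : Vec Bool m) → All (s ≤_) (support s x)
support-≥ s []          = []
support-≥ s (true  ∷ x) = ≤-refl ∷ All.map <⇒≤ (support-≥ (suc s) x)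
support-≥ s (false ∷ x) = All.map <⇒≤ (support-≥ (suc s) x)

support-< : ∀ {m} s (x : Vec Bool m) → All (_< s + m) (support s x)
support-< s []                  = []
support-< {suc m} s (true  ∷ x) = m<m+n s z<s ∷ All<-+-suc⁻¹ s m (support-< (suc s) x)
support-< {suc m} s (false ∷ x) = All<-+-suc⁻¹ s m (support-< (suc s) x)

support-sorted : ∀ {m} s (x : Vec Bool m) → AllPairs _<_ (support s x)
support-sorted s []          = []
support-sorted s (true  ∷ x) = support-≥ (suc s) x ∷ support-sorted (suc s) x
support-sorted s (false ∷ x) = support-sorted (suc s) x

support-nonZero : ∀ {m} s .{{_ : NonZero s}} (x : Vec Bool m) → All NonZero (support s x)
support-nonZero s x = All.map (λ s≤a → >-nonZero (<-≤-trans (>-nonZero⁻¹ s) s≤a)) (support-≥ s x)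

∷≢support : ∀ {m} s L (x : Vec Bool m) → s ∷ L ≢ support (suc s) x
∷≢support s L x e with s<s′ ∷ _ ← subst (All (suc s ≤_)) (sym e) (support-≥ (suc s) x) =
  <-irrefl refl s<s′

support-injective : ∀ {m} s (x y : Vec Bool m) → support s x ≡ support s y → x ≡ y
support-injective s []          []          _ = refl
support-injective s (true  ∷ x) (true  ∷ y) e =
  cong (true ∷_) (support-injective (suc s) x y (∷-injectiveʳ e))
support-injective s (false ∷ x) (false ∷ y) e = cong (false ∷_) (support-injective (suc s) x y e)
support-injective s (true  ∷ x) (false ∷ y) e = ⊥-elim (∷≢support s _ y e)
support-injective s (false ∷ x) (true  ∷ y) e = ⊥-elim (∷≢support s _ x (sym e))

support-surjective : ∀ m s {L} → AllPairs _<_ L → All (s ≤_) L → All (_< s + m) L →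
                     ∃[ x ] support {m} s x ≡ L
support-surjective zero    s {[]}    _ _ _ = [] , refl
support-surjective zero    s {a ∷ _} _ (s≤a ∷ _) (a<s+0 ∷ _) =
  ⊥-elim (<⇒≱ a<s+0 (subst (_≤ a) (sym (+-identityʳ s)) s≤a))
support-surjective (suc m) s {[]} _ _ _ =
  let x , e = support-surjective m (suc s) [] [] [] in false ∷ x , e
support-surjective (suc m) s {a ∷ L} (a<L ∷ sorted) (s≤a ∷ _) bounded with s ≟ a
... | yes refl =
  let x , e = support-surjective m (suc s) sorted a<L (All<-+-suc s m (All.tail bounded))
  in true ∷ x , cong (s ∷_) e
... | no s≢a =
  let x , e = support-surjective m (suc s) (a<L ∷ sorted) (s<a ∷ All.map (<-trans s<a) a<L)
                                 (All<-+-suc s m bounded)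
  in false ∷ x , e
  where s<a = ≤∧≢⇒< s≤a s≢a

-- rowA ℓ r p is parityRow p ℓ at length suc r ∸ ℓ.
parityRow : ∀ {m} → ℕ → ℕ → Vec Bool m
parityRow p s = tabulate (λ j → vbit p (s + toℕ j))

parityRow-suc : ∀ {m} p s → parityRow {suc m} p s ≡ vbit p s ∷ parityRow p (suc s)
parityRow-suc p s =
  cong₂ _∷_ (cong (vbit p) (+-identityʳ s)) (tabulate-cong (cong (vbit p) ∘ +-suc s ∘ toℕ))

dot-parityRow : Prime p → ∀ {m} s .{{_ : NonZero s}} (x : Vec Bool m) →
                dot (parityRow p s) x ≡ vbit p (product (support s x))
dot-parityRow p-prime s [] = sym (vbit-∤ (>1⇒∤1 (prime⇒>1 p-prime)))
dot-parityRow {p} p-prime s (true ∷ x) = begin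
  dot (parityRow p s) (true ∷ x)
    ≡⟨ cong (λ r → dot r (true ∷ x)) (parityRow-suc p s) ⟩
  vbit p s ∧ true xor dot (parityRow p (suc s)) x
    ≡⟨ cong₂ _xor_ (∧-identityʳ (vbit p s)) (dot-parityRow p-prime (suc s) x) ⟩
  vbit p s xor vbit p (product (support (suc s) x))
    ≡⟨ vbit-* p-prime s _ ⟨
  vbit p (s * product (support (suc s) x))
    ∎
  where
  open ≡-Reasoning
  instance
    _ : NonZero (product (support (suc s) x))
    _ = product≢0 (support-nonZero (suc s) x)
dot-parityRow {p} p-prime s (false ∷ x) = begin
  dot (parityRow p s) (false ∷ x)
    ≡⟨ cong (λ r → dot r (false ∷ x)) (parityRow-suc p s) ⟩
  vbit p s ∧ false xor dot (parityRow p (suc s)) x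
    ≡⟨ cong₂ _xor_ (∧-zeroʳ (vbit p s)) (dot-parityRow p-prime (suc s) x) ⟩
  vbit p (product (support (suc s) x))
    ∎
  where open ≡-Reasoning

Linked⇒≤last : ∀ {k L} → Linked _<_ L → last L ≡ just k → All (_≤ k) L
Linked⇒≤last [-]          refl = ≤-refl ∷ []
Linked⇒≤last (a<b ∷ sorted) e with b≤k ∷ rest≤k ← Linked⇒≤last sorted e =
  <⇒≤ (<-≤-trans a<b b≤k) ∷ b≤k ∷ rest≤k

last-All : ∀ {P : ℕ → Set} a L → All P (a ∷ L) → ∃[ b ] last (a ∷ L) ≡ just b × P b
last-All a []      (Pa ∷ []) = a , refl , Pa
last-All a (b ∷ L) (_ ∷ PL)  = last-All b L PL

prime∤product : Prime p → ∀ {L} → All (p ∤_) L → p ∤ product L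
prime∤product p-prime []          = >1⇒∤1 (prime⇒>1 p-prime)
prime∤product p-prime (p∤a ∷ p∤L) = [ p∤a , prime∤product p-prime p∤L ]′ ∘ euclidsLemma _ _ p-prime

nullSpace-row : ∀ {B ℓ r y} → InNullSpace B ℓ r y → Prime p → p ≤ B → dot (rowA ℓ r p) y ≡ false
nullSpace-row {p} {ℓ = ℓ} {r} {y} y∈ker p-prime p≤B =
  subst (λ q → dot (rowA ℓ r q) y ≡ false) (toℕ-fromℕ< (s≤s p≤B))
        (y∈ker (fromℕ< (s≤s p≤B) , subst Prime (sym (toℕ-fromℕ< (s≤s p≤B))) p-prime))

corrSeq⇒≤ : ∀ {n k} → CorrSeq n k → n ≤ k
corrSeq⇒≤ (_ ∷ _ , refl , sorted , last≡k , _) = All.head (Linked⇒≤last sorted last≡k)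

last≡g : ∀ {n k} → ¬ IsSquare n → (∀ k′ → k′ < k → ¬ CorrSeq n k′) →
         ∀ L → Linked _<_ (n ∷ L) → All (_≤ k) L → IsSquare (product (n ∷ L)) → last (n ∷ L) ≡ just k
last≡g {n} ¬square _ [] _ _ square = ⊥-elim (¬square (subst IsSquare (*-identityʳ n) square))
last≡g {n} ¬square minimal (a ∷ L) sorted ≤k square with b , last≡b , b≤k ← last-All a L ≤k =
  trans last≡b (cong just (≤-antisym b≤k (≮⇒≥ λ b<k →
    minimal b b<k (n ∷ a ∷ L , refl , sorted , last≡b , square))))

module Encoding (n k : ℕ) where

  Columns : Set
  Columns = Vec Bool (suc k ∸ suc n)

  row : ℕ → Columns
  row p = rowA (suc n) k p

  decode : Columns → List ℕ
  decode x = n ∷ support (suc n) x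

  decode-injective : ∀ {x y} → decode x ≡ decode y → x ≡ y
  decode-injective = support-injective (suc n) _ _ ∘ ∷-injectiveʳ

  decode-sorted : ∀ x → Linked _<_ (decode x)
  decode-sorted x = AllPairs⇒Linked (support-≥ (suc n) x ∷ support-sorted (suc n) x)

  decode-nonZero : 0 < n → ∀ x → All NonZero (decode x)
  decode-nonZero 0<n x = >-nonZero 0<n ∷ support-nonZero (suc n) x

  decode-≤ : n ≤ k → ∀ x → All (_≤ k) (decode x)
  decode-≤ n≤k x =
    n≤k ∷ All.map (λ a<end → ≤-trans (s≤s⁻¹ a<end) (≤-reflexive (m+[n∸m]≡n n≤k))) (support-< (suc n) x)

  vbit-decode : 0 < n → Prime p → ∀ x → vbit p (product (decode x)) ≡ vbit p n xor dot (row p) x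
  vbit-decode 0<n p-prime x =
    trans (vbit-* p-prime n _) (cong (vbit _ n xor_) (sym (dot-parityRow p-prime (suc n) x)))
    where
    instance
      _ : NonZero n
      _ = >-nonZero 0<n
      _ : NonZero (product (support (suc n) x))
      _ = product≢0 (support-nonZero (suc n) x)

  corrSeq-decoded : (c : CorrSeq n k) → ∃[ x ] decode x ≡ proj₁ c
  corrSeq-decoded (_ ∷ rest , refl , sorted , last≡k , _)
    with n<rest ∷ rest-sorted ← Linked⇒AllPairs <-trans sorted
       | n≤k ∷ rest≤k ← Linked⇒≤last sorted last≡k =
    let x , e = support-surjective _ (suc n) rest-sorted n<rest
                  (All.map (λ a≤k → s≤s (≤-trans a≤k (≤-reflexive (sym (m+[n∸m]≡n n≤k))))) rest≤k)
    in x , cong (n ∷_) e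

  code : CorrSeq n k → Columns
  code c = proj₁ (corrSeq-decoded c)

  decode-code : ∀ c → decode (code c) ≡ proj₁ c
  decode-code c = proj₂ (corrSeq-decoded c)

  code-unique : ∀ c {x} → proj₁ c ≡ decode x → code c ≡ x
  code-unique c e = decode-injective (trans (decode-code c) e)

  code-injective : ∀ a b → code a ≡ code b → proj₁ a ≡ proj₁ b
  code-injective a b e = trans (sym (decode-code a)) (trans (cong decode e) (decode-code b))

  dot-code : 0 < n → ∀ c → Prime p → dot (row p) (code c) ≡ vbit p n
  dot-code {p} 0<n c@(_ , _ , _ , _ , square) p-prime = sym (xor≡false⇒≡ _ _ (begin
    vbit p n xor dot (row p) (code c)   ≡⟨ vbit-decode 0<n p-prime (code c) ⟨
    vbit p (product (decode (code c)))  ≡⟨ cong (vbit p ∘ product) (decode-code c) ⟩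
    vbit p (product (proj₁ c))          ≡⟨ square⇒vbit≡false p-prime square ⟩
    false                               ∎))
    where open ≡-Reasoning

  code-⊕-code∈nullSpace : 0 < n → ∀ a b → InNullSpace k (suc n) k (code a ⊕ code b)
  code-⊕-code∈nullSpace 0<n a b (i , q-prime) = begin
    dot (row q) (code a ⊕ code b)
      ≡⟨ dot-⊕ (row q) (code a) (code b) ⟩
    dot (row q) (code a) xor dot (row q) (code b)
      ≡⟨ cong₂ _xor_ (dot-code 0<n a q-prime) (dot-code 0<n b q-prime) ⟩
    vbit q n xor vbit q n
      ≡⟨ xor-same (vbit q n) ⟩
    false
      ∎
    where
    open ≡-Reasoning
    q = toℕ i

  decode-square : 0 < n → n ≤ k → ∀ x → (∀ {q} → Prime q → q ≤ k → dot (row q) x ≡ vbit q n) →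
                  IsSquare (product (decode x))
  decode-square 0<n n≤k x rows = vbit≡false⇒square _ {{product≢0 (decode-nonZero 0<n x)}} even
    where
    even : ∀ q → Prime q → vbit q (product (decode x)) ≡ false
    even q q-prime with q ≤? k
    ... | yes q≤k = begin
      vbit q (product (decode x))  ≡⟨ vbit-decode 0<n q-prime x ⟩
      vbit q n xor dot (row q) x   ≡⟨ cong (vbit q n xor_) (rows q-prime q≤k) ⟩
      vbit q n xor vbit q n        ≡⟨ xor-same (vbit q n) ⟩
      false                        ∎
      where open ≡-Reasoning
    ... | no q≰k = vbit-∤ (prime∤product q-prime (All.zipWith
      (λ (a≢0 , a≤k) → >⇒∤ {{a≢0}} (≤-<-trans a≤k (≰⇒> q≰k))) (decode-nonZero 0<n x , decode-≤ n≤k x)))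

  decode-corrSeq : 0 < n → ¬ IsSquare n → IsG n k → ∀ x →
                   (∀ {q} → Prime q → q ≤ k → dot (row q) x ≡ vbit q n) → IsCorrSeq n k (decode x)
  decode-corrSeq 0<n ¬square (c₀ , minimal) x rows =
    refl , decode-sorted x , last≡g ¬square minimal _ (decode-sorted x) (All.tail (decode-≤ n≤k x)) square
    , square
    where
    n≤k = corrSeq⇒≤ c₀
    square = decode-square 0<n n≤k x rows

  dot-⊕-code : 0 < n → ∀ {y} → InNullSpace k (suc n) k y → ∀ c {q} → Prime q → q ≤ k →
               dot (row q) (y ⊕ code c) ≡ vbit q n
  dot-⊕-code 0<n {y} y∈ker c {q} q-prime q≤k =
    trans (dot-⊕ (row q) y (code c))
          (cong₂ _xor_ (nullSpace-row {ℓ = suc n} {r = k} y∈ker q-prime q≤k) (dot-code 0<n c q-prime))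

lemma2p8 : (n k : ℕ) → 0 < n → ¬ IsSquare n → IsG n k →
    Bijection (CorrSeqSetoid n k) (NullSpaceSetoid k (suc n) k)
lemma2p8 n k 0<n ¬square isG@(c₀ , _) = record
  { to        = to
  ; cong      = λ {a} {b} a≡b → cong (_⊕ x₀) (code-unique a (trans a≡b (sym (decode-code b))))
  ; bijective = (λ {a} {b} → code-injective a b ∘ ⊕-injectiveˡ x₀)
              , λ (y , y∈ker) →
                  (decode (y ⊕ x₀) , decode-corrSeq 0<n ¬square isG _ (dot-⊕-code 0<n y∈ker c₀))
                , λ {c} c≡ → trans (cong (_⊕ x₀) (code-unique c c≡)) (⊕-cancelʳ y x₀)
  }
  where
  open Encoding n k
  x₀ : Columns
  x₀ = code c₀
  to : CorrSeq n k → NullSpace k (suc n) k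
  to c = code c ⊕ x₀ , code-⊕-code∈nullSpace 0<n c c₀
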